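{- Let $D(x)=1-2x-2x^2+x^3$ and define integer sequences by the formal power series expansions \[ \frac{8+8x+24x^2}{D(x)}=\sum_{n\ge0}a_nx^n,\ \frac{6-68x+18x^2}{D(x)}=\sum_{n\ge0}b_nx^n,\ \frac{14-60x+42x^2}{D(x)}=\sum_{n\ge0}c_nx^n, \] \[ \frac{9+18x-27x^2}{D(x)}=\sum_{n\ge0}d_nx^n,\ \frac{4+8x-12x^2}{D(x)}=\sum_{n\ge0}e_nx^n,\ \frac{15+30x-45x^2}{D(x)}=\sum_{n\ge0}f_nx^n. \] Then for all $n\ge0$, $a_n^4+b_n^4+c_n^4+d_n^4+e_n^4=f_n^4$. -}

module Defs where

open import Data.Nat using (ℕ; zero; suc)
open import Data.Integer using (ℤ; +_; -_; _+_; _*_; _-_; _^_)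
open import Data.List using (List; []; _∷_)

-- A polynomial is given by its list of integer coefficients, constant term first.
Poly : Set
Poly = List ℤ

coeff : Poly → ℕ → ℤ
coeff []       _       = + 0
coeff (a ∷ _)  zero    = a
coeff (_ ∷ p)  (suc n) = coeff p n

-- Formal power series division P(x)/Q(x) where Q has constant term 1,
-- Q = 1 + q₁ x + q₂ x² + ... (the list qs = [q₁, q₂, ...]).
-- The coefficients s of the quotient are the unique solution of Q·s = P:
--   s n = p n - Σ_{k=1}^{n} q_k · s (n - k).
private
  -- Σ_{k≥1} q_k * prev_{k-1}, where prev = [s (n-1), s (n-2), ..., s 0]
  conv : Poly → List ℤ → ℤ
  conv []       _          = + 0
  conv _        []         = + 0
  conv (q ∷ qs) (s ∷ ss)   = q * s + conv qs ss

  prefix : Poly → Poly → ℕ → List ℤ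
  prefix p qs zero    = coeff p 0 ∷ []
  prefix p qs (suc n) = let prev = prefix p qs n in
                        (coeff p (suc n) - conv qs prev) ∷ prev

  headOr0 : List ℤ → ℤ
  headOr0 []      = + 0
  headOr0 (x ∷ _) = x

seriesDiv : Poly → Poly → ℕ → ℤ
seriesDiv p qs n = headOr0 (prefix p qs n)

Dtail : Poly
Dtail = - + 2 ∷ - + 2 ∷ + 1 ∷ []

a b c d e f : ℕ → ℤ
a = seriesDiv (+ 8 ∷ + 8 ∷ + 24 ∷ []) Dtail
b = seriesDiv (+ 6 ∷ - + 68 ∷ + 18 ∷ []) Dtail
c = seriesDiv (+ 14 ∷ - + 60 ∷ + 42 ∷ []) Dtail
d = seriesDiv (+ 9 ∷ + 18 ∷ - + 27 ∷ []) Dtail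
e = seriesDiv (+ 4 ∷ + 8 ∷ - + 12 ∷ []) Dtail
f = seriesDiv (+ 15 ∷ + 30 ∷ - + 45 ∷ []) Dtail

module Submission where

open import Defs
open import Data.Nat using (ℕ; zero; suc)
open import Data.Integer using (ℤ; +_; -_; _+_; _-_; _*_; _^_; NonZero)
open import Data.Integer.Properties
  using (*-cancelˡ-≡; i*j≢0; +-*-commutativeSemiring)
open import Algebra.Properties.CommutativeSemiring.Exp +-*-commutativeSemiring
  using (^-distrib-*)
open import Data.Integer.Tactic.RingSolver using (solve-∀)
open import Data.List using ([]; _∷_)
open import Relation.Binary.PropositionalEquality
  using (_≡_; refl; sym; trans; cong; cong₂; module ≡-Reasoning)

-- D(x) = (1 + x)(1 − 3x + x²), so every sequence with generating function
-- (numerator of degree < 3)/D(x) lies in the span of F(2n + 2), F(2n) and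
-- (−1)ⁿ, F the Fibonacci numbers; five times each of a, …, f is an integral
-- combination of these.  In these coordinates the claim becomes a homogeneous
-- quartic identity in (X, Y, s) holding modulo X² − 3XY + Y² − s², and
-- F(2n + 2)² − 3 F(2n + 2) F(2n) + F(2n)² = 1 = ((−1)ⁿ)².

record RecurrentD (s : ℕ → ℤ) : Set where
  constructor recurrentD
  field
    recurrence : ∀ n → s (suc (suc (suc n))) ≡ + 2 * s (suc (suc n)) + + 2 * s (suc n) - s n

open RecurrentD

recurrentD-unique : ∀ {s t} → RecurrentD s → RecurrentD t →
                    s 0 ≡ t 0 → s 1 ≡ t 1 → s 2 ≡ t 2 → ∀ n → s n ≡ t n
recurrentD-unique {s} {t} rs rt e₀ e₁ e₂ = agree
  where
  agree : ∀ n → s n ≡ t n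
  agree 0 = e₀
  agree 1 = e₁
  agree 2 = e₂
  agree (suc (suc (suc n))) = begin
    s (suc (suc (suc n)))                              ≡⟨ recurrence rs n ⟩
    + 2 * s (suc (suc n)) + + 2 * s (suc n) - s n      ≡⟨ cong (λ u → + 2 * u + + 2 * s (suc n) - s n) (agree (suc (suc n))) ⟩
    + 2 * t (suc (suc n)) + + 2 * s (suc n) - s n      ≡⟨ cong (λ u → + 2 * t (suc (suc n)) + + 2 * u - s n) (agree (suc n)) ⟩
    + 2 * t (suc (suc n)) + + 2 * t (suc n) - s n      ≡⟨ cong (λ u → + 2 * t (suc (suc n)) + + 2 * t (suc n) - u) (agree n) ⟩
    + 2 * t (suc (suc n)) + + 2 * t (suc n) - t n      ≡⟨ sym (recurrence rt n) ⟩
    t (suc (suc (suc n)))                              ∎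
    where open ≡-Reasoning

recurrentD-suc : ∀ {s} → RecurrentD s → RecurrentD (λ n → s (suc n))
recurrentD-suc rs = recurrentD (λ n → recurrence rs (suc n))

recurrentD-* : ∀ {s} k → RecurrentD s → RecurrentD (λ n → k * s n)
recurrentD-* {s} k rs = recurrentD λ n →
  trans (cong (k *_) (recurrence rs n)) (distrib k (s (suc (suc n))) (s (suc n)) (s n))
  where
  distrib : ∀ k x₂ x₁ x₀ → k * (+ 2 * x₂ + + 2 * x₁ - x₀) ≡ + 2 * (k * x₂) + + 2 * (k * x₁) - k * x₀
  distrib = solve-∀

recurrentD-+ : ∀ {s t} → RecurrentD s → RecurrentD t → RecurrentD (λ n → s n + t n)
recurrentD-+ {s} {t} rs rt = recurrentD λ n →
  trans (cong₂ _+_ (recurrence rs n) (recurrence rt n))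
        (regroup (s (suc (suc n))) (s (suc n)) (s n) (t (suc (suc n))) (t (suc n)) (t n))
  where
  regroup : ∀ x₂ x₁ x₀ y₂ y₁ y₀ →
            (+ 2 * x₂ + + 2 * x₁ - x₀) + (+ 2 * y₂ + + 2 * y₁ - y₀)
            ≡ + 2 * (x₂ + y₂) + + 2 * (x₁ + y₁) - (x₀ + y₀)
  regroup = solve-∀

seriesDiv-recurrentD : ∀ x y z → RecurrentD (seriesDiv (x ∷ y ∷ z ∷ []) Dtail)
seriesDiv-recurrentD x y z = recurrentD λ n →
  trans (unfold n) (normalise (s (suc (suc n))) (s (suc n)) (s n))
  where
  s : ℕ → ℤ
  s = seriesDiv (x ∷ y ∷ z ∷ []) Dtail
  unfold : ∀ n → s (suc (suc (suc n)))
                 ≡ + 0 - (- + 2 * s (suc (suc n)) + (- + 2 * s (suc n) + (+ 1 * s n + + 0)))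
  unfold zero    = refl
  unfold (suc n) = refl
  normalise : ∀ x₂ x₁ x₀ → + 0 - (- + 2 * x₂ + (- + 2 * x₁ + (+ 1 * x₀ + + 0))) ≡ + 2 * x₂ + + 2 * x₁ - x₀
  normalise = solve-∀

-- evenFib n = F(2n).
evenFib : ℕ → ℤ
evenFib 0             = + 0
evenFib 1             = + 1
evenFib (suc (suc n)) = + 3 * evenFib (suc n) - evenFib n

evenFib-recurrentD : RecurrentD evenFib
evenFib-recurrentD = recurrentD λ n → step (evenFib (suc n)) (evenFib n)
  where
  step : ∀ x₁ x₀ → + 3 * (+ 3 * x₁ - x₀) - x₁ ≡ + 2 * (+ 3 * x₁ - x₀) + + 2 * x₁ - x₀
  step = solve-∀

evenFib-cassini : ∀ n → evenFib (suc n) * evenFib (suc n) - + 3 * evenFib (suc n) * evenFib n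
                        + evenFib n * evenFib n ≡ + 1
evenFib-cassini zero    = refl
evenFib-cassini (suc n) = trans (step (evenFib (suc n)) (evenFib n)) (evenFib-cassini n)
  where
  step : ∀ x₁ x₀ → (+ 3 * x₁ - x₀) * (+ 3 * x₁ - x₀) - + 3 * (+ 3 * x₁ - x₀) * x₁ + x₁ * x₁
                   ≡ x₁ * x₁ - + 3 * x₁ * x₀ + x₀ * x₀
  step = solve-∀

alternating-recurrentD : RecurrentD (λ n → (- + 1) ^ n)
alternating-recurrentD = recurrentD λ n → step ((- + 1) ^ n)
  where
  step : ∀ x → - + 1 * (- + 1 * (- + 1 * x)) ≡ + 2 * (- + 1 * (- + 1 * x)) + + 2 * (- + 1 * x) - x
  step = solve-∀

alternating-square : ∀ n → (- + 1) ^ n * (- + 1) ^ n ≡ + 1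
alternating-square zero    = refl
alternating-square (suc n) = trans (step ((- + 1) ^ n)) (alternating-square n)
  where
  step : ∀ x → (- + 1 * x) * (- + 1 * x) ≡ x * x
  step = solve-∀

combination-recurrentD : ∀ β α γ →
  RecurrentD (λ n → β * evenFib (suc n) + α * evenFib n + γ * (- + 1) ^ n)
combination-recurrentD β α γ =
  recurrentD-+ (recurrentD-+ (recurrentD-* β (recurrentD-suc evenFib-recurrentD))
                             (recurrentD-* α evenFib-recurrentD))
               (recurrentD-* γ alternating-recurrentD)

seriesDiv-as-combination :
  ∀ k x y z β α γ → let s = seriesDiv (x ∷ y ∷ z ∷ []) Dtail
                        u = λ n → β * evenFib (suc n) + α * evenFib n + γ * (- + 1) ^ n in
  k * s 0 ≡ u 0 → k * s 1 ≡ u 1 → k * s 2 ≡ u 2 → ∀ n → k * s n ≡ u n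
seriesDiv-as-combination k x y z β α γ =
  recurrentD-unique (recurrentD-* k (seriesDiv-recurrentD x y z))
                    (combination-recurrentD β α γ)

x+k*[y-z]≡x : ∀ x k {y z} → y ≡ z → x + k * (y - z) ≡ x
x+k*[y-z]≡x x k {y} refl = vanish x k y
  where
  vanish : ∀ x k y → x + k * (y - y) ≡ x
  vanish = solve-∀

-- The cofactor of X² − 3XY + Y² − s² was found by polynomial division.
-- solve-∀ does not recognise ℤ's _^_, so identities are solved with x ⁴
-- spelled out as the product that x ^ 4 unfolds to.
fourth-power-identity :
  ∀ X Y s → X * X - + 3 * X * Y + Y * Y ≡ s * s →
  (+ 16 * X + + 96 * Y + + 24 * s) ^ 4 + (- + 62 * X + - + 2 * Y + + 92 * s) ^ 4
    + (- + 46 * X + + 94 * Y + + 116 * s) ^ 4 + (+ 81 * X + - + 99 * Y + - + 36 * s) ^ 4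
    + (+ 36 * X + - + 44 * Y + - + 16 * s) ^ 4
  ≡ (+ 135 * X + - + 165 * Y + - + 60 * s) ^ 4
fourth-power-identity X Y s Q≡s² =
  trans (expanded X Y s) (x+k*[y-z]≡x ((+ 135 * X + - + 165 * Y + - + 60 * s) ^ 4) cofactor Q≡s²)
  where
  cofactor : ℤ
  cofactor = - + 268104960 * X * X + + 567751680 * X * Y + + 378501120 * X * s
             + - + 478383360 * Y * Y + - + 462612480 * Y * s + - + 241820160 * s * s
  expanded : ∀ X Y s → let _⁴ : ℤ → ℤ
                           x ⁴ = x * (x * (x * (x * + 1))) in
    (+ 16 * X + + 96 * Y + + 24 * s) ⁴ + (- + 62 * X + - + 2 * Y + + 92 * s) ⁴
      + (- + 46 * X + + 94 * Y + + 116 * s) ⁴ + (+ 81 * X + - + 99 * Y + - + 36 * s) ⁴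
      + (+ 36 * X + - + 44 * Y + - + 16 * s) ⁴
    ≡ (+ 135 * X + - + 165 * Y + - + 60 * s) ⁴
      + (- + 268104960 * X * X + + 567751680 * X * Y + + 378501120 * X * s
         + - + 478383360 * Y * Y + - + 462612480 * Y * s + - + 241820160 * s * s)
        * (X * X - + 3 * X * Y + Y * Y - s * s)
  expanded = solve-∀

^-nonZero : ∀ i n .{{_ : NonZero i}} → NonZero (i ^ n)
^-nonZero i zero    = _
^-nonZero i (suc n) = i*j≢0 i (i ^ n)
  where instance
  iⁿ≢0 : NonZero (i ^ n)
  iⁿ≢0 = ^-nonZero i n

fourth-powers-cancel :
  ∀ k .{{_ : NonZero k}} {x₁ x₂ x₃ x₄ x₅ y l₁ l₂ l₃ l₄ l₅ m} →
  k * x₁ ≡ l₁ → k * x₂ ≡ l₂ → k * x₃ ≡ l₃ → k * x₄ ≡ l₄ → k * x₅ ≡ l₅ → k * y ≡ m →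
  l₁ ^ 4 + l₂ ^ 4 + l₃ ^ 4 + l₄ ^ 4 + l₅ ^ 4 ≡ m ^ 4 →
  x₁ ^ 4 + x₂ ^ 4 + x₃ ^ 4 + x₄ ^ 4 + x₅ ^ 4 ≡ y ^ 4
fourth-powers-cancel k {x₁} {x₂} {x₃} {x₄} {x₅} {y} refl refl refl refl refl refl eq =
  -- ^-distrib-* concerns the generic semiring power, which unfolds to ℤ's _^_ at exponent 4.
  *-cancelˡ-≡ (k ^ 4) _ _ {{^-nonZero k 4}}
    (trans (sym (factor k x₁ x₂ x₃ x₄ x₅)) (trans eq (^-distrib-* k y 4)))
  where
  factor : ∀ k x₁ x₂ x₃ x₄ x₅ → let _⁴ : ℤ → ℤ
                                    x ⁴ = x * (x * (x * (x * + 1))) in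
    (k * x₁) ⁴ + (k * x₂) ⁴ + (k * x₃) ⁴ + (k * x₄) ⁴ + (k * x₅) ⁴
    ≡ k ⁴ * (x₁ ⁴ + x₂ ⁴ + x₃ ⁴ + x₄ ⁴ + x₅ ⁴)
  factor = solve-∀

theorem2p6 : (n : ℕ) → a n ^ 4 + b n ^ 4 + c n ^ 4 + d n ^ 4 + e n ^ 4 ≡ f n ^ 4
theorem2p6 n =
  fourth-powers-cancel (+ 5)
    (seriesDiv-as-combination (+ 5) (+ 8) (+ 8) (+ 24) (+ 16) (+ 96) (+ 24) refl refl refl n)
    (seriesDiv-as-combination (+ 5) (+ 6) (- + 68) (+ 18) (- + 62) (- + 2) (+ 92) refl refl refl n)
    (seriesDiv-as-combination (+ 5) (+ 14) (- + 60) (+ 42) (- + 46) (+ 94) (+ 116) refl refl refl n)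
    (seriesDiv-as-combination (+ 5) (+ 9) (+ 18) (- + 27) (+ 81) (- + 99) (- + 36) refl refl refl n)
    (seriesDiv-as-combination (+ 5) (+ 4) (+ 8) (- + 12) (+ 36) (- + 44) (- + 16) refl refl refl n)
    (seriesDiv-as-combination (+ 5) (+ 15) (+ 30) (- + 45) (+ 135) (- + 165) (- + 60) refl refl refl n)
    (fourth-power-identity (evenFib (suc n)) (evenFib n) ((- + 1) ^ n)
      (trans (evenFib-cassini n) (sym (alternating-square n))))
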